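{- For every integer $N\ge0$, \[\det\left[\frac{(2i+1)\,(2(i+j))!}{j!\,(2i+j+1)!}\right]_{0\le i,j\le N}=2^{\frac{N(N+1)}{2}}.\] -}

module Defs where

open import Data.Nat as ℕ using (ℕ; zero; suc; _!)
open import Data.Nat.Properties using (_!*_!≢0)
open import Data.Integer using (+_)
open import Data.Fin using (Fin; zero; suc; punchIn; toℕ)
open import Data.Rational using (ℚ; 0ℚ; 1ℚ; _+_; _*_; -_; _/_)

sumFin : ∀ n → (Fin n → ℚ) → ℚ
sumFin zero    f = 0ℚ
sumFin (suc n) f = f zero + sumFin n (λ k → f (suc k))

sign : ℕ → ℚ
sign zero    = 1ℚ
sign (suc k) = - sign k

det : ∀ n → (Fin n → Fin n → ℚ) → ℚ
det zero    M = 1ℚ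
det (suc n) M = sumFin (suc n) λ j →
  sign (toℕ j) * (M zero j * det n (λ i k → M (suc i) (punchIn j k)))

entry : ℕ → ℕ → ℚ
entry i j = (+ ((2 ℕ.* i ℕ.+ 1) ℕ.* (2 ℕ.* (i ℕ.+ j)) !))
            / (j ! ℕ.* (2 ℕ.* i ℕ.+ j ℕ.+ 1) !)
  where instance _ = j !* (2 ℕ.* i ℕ.+ j ℕ.+ 1) !≢0

module Submission where

-- The (i, j) entry is the ballot number a(2i+1, j), where a(r, 0) = 1, a(0, n+1) = 0 and
-- a(r+1, n+1) = a(r, n+1) + a(r+2, n).  Embed the matrix in the family M_N(s, k) with entries
-- F(s+2i, k, j), where F(s, k, n) = Σₘ (k choose m) a(s+m, n).  The recurrence gives
-- F(s+2, k, n+1) = F(s+2, k+1, n) + F(s, k, n+1), and F(s, k, 0) = 2^k, so subtracting from each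
-- row the row above it (bottom row first) leaves 2^k in the corner, zeros below it, and
-- M_{N-1}(s+2, k+1) as the complementary minor.  Hence det M_N(s, k) = 2^k · det M_{N-1}(s+2, k+1),
-- which unfolds to 2^(k(N+1) + N(N+1)/2); the theorem is the case s = 1, k = 0.

open import Defs
open import Algebra.Bundles using (CommutativeRing)
open import Data.Fin as Fin using (Fin; zero; suc; punchIn; toℕ; inject₁; fromℕ<)
import Data.Fin.Properties as Fin
import Data.Integer as ℤ
import Data.Integer.Properties as ℤ
open import Data.Nat as ℕ using (ℕ; zero; suc; _≤_; _<_; _≤?_; _<?_; s≤s; _!; _^_)
import Data.Nat.DivMod as ℕ
import Data.Nat.Divisibility as ℕ
import Data.Nat.Properties as ℕ
open import Data.Nat.Tactic.RingSolver using (solve-∀)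
open import Data.Rational as ℚ using (ℚ; 0ℚ; 1ℚ)
import Data.Rational.Properties as ℚ
open import Data.Rational.Solver using (module +-*-Solver)
import Data.Rational.Unnormalised as ℚᵘ
import Data.Rational.Unnormalised.Properties as ℚᵘ
open import Data.Vec.Functional using (updateAt)
open import Data.Vec.Functional.Properties using (updateAt-updates; updateAt-minimal)
open import Function using (_∘_)
open import Relation.Binary.PropositionalEquality
open import Relation.Nullary using (yes; no; contradiction)

module Determinant where
  open import Data.Rational using (_+_; _*_; -_)
  open import Algebra.Properties.Semiring.Sum (CommutativeRing.semiring ℚ.+-*-commutativeRing)
    using (sum; sum-cong-≗; sum-replicate-zero; ∑-distrib-+; ∑-comm; *-distribˡ-sum)
  open +-*-Solver using (solve; _:=_; _:*_; :-_)
  open ≡-Reasoning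

  sumFin≡sum : ∀ n (f : Fin n → ℚ) → sumFin n f ≡ sum f
  sumFin≡sum zero    f = refl
  sumFin≡sum (suc n) f = cong (f zero +_) (sumFin≡sum n (f ∘ suc))

  sum-zero : ∀ {n} {f : Fin n → ℚ} → (∀ i → f i ≡ 0ℚ) → sum f ≡ 0ℚ
  sum-zero {n} f≡0 = trans (sum-cong-≗ f≡0) (sum-replicate-zero n)

  *-distribˡ-sum² : ∀ {n} a b (f : Fin n → ℚ) → a * (b * sum f) ≡ sum (λ i → a * (b * f i))
  *-distribˡ-sum² {n} a b f = trans (cong (a *_) (*-distribˡ-sum {n} b f)) (*-distribˡ-sum {n} a _)

  *-zeroʳ² : ∀ a b {d} → d ≡ 0ℚ → a * (b * d) ≡ 0ℚ
  *-zeroʳ² a b refl = trans (cong (a *_) (ℚ.*-zeroʳ b)) (ℚ.*-zeroʳ a)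

  Matrix : ℕ → Set
  Matrix n = Fin n → Fin n → ℚ

  minor : ∀ {n} → Matrix (suc n) → Fin (suc n) → Fin (suc n) → Matrix n
  minor M i j r c = M (punchIn i r) (punchIn j c)

  cofactorTerm : ∀ {n} → Matrix (suc n) → Fin (suc n) → ℚ
  cofactorTerm {n} M j = sign (toℕ j) * (M zero j * det n (minor M zero j))

  det-suc : ∀ {n} (M : Matrix (suc n)) → det (suc n) M ≡ sum (cofactorTerm M)
  det-suc {n} M = sumFin≡sum (suc n) (cofactorTerm M)

  det-cong : ∀ n {M M′ : Matrix n} → (∀ i j → M i j ≡ M′ i j) → det n M ≡ det n M′
  det-cong zero    _ = refl
  det-cong (suc n) {M} {M′} M≡M′ = begin
    det (suc n) M          ≡⟨ det-suc M ⟩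
    sum (cofactorTerm M)   ≡⟨ sum-cong-≗ term≡ ⟩
    sum (cofactorTerm M′)  ≡⟨ det-suc M′ ⟨
    det (suc n) M′         ∎
    where
    term≡ : ∀ j → cofactorTerm M j ≡ cofactorTerm M′ j
    term≡ j = cong₂ (λ x d → sign (toℕ j) * (x * d))
                    (M≡M′ zero j) (det-cong n (λ r c → M≡M′ (suc r) (punchIn j c)))

  det≡columnExpansion : ∀ n (M : Matrix (suc n)) →
    det (suc n) M ≡ sum (λ i → sign (toℕ i) * (M i zero * det n (minor M i zero)))
  det≡columnExpansion zero    M = refl
  det≡columnExpansion (suc n) M = begin
    det (suc (suc n)) M
      ≡⟨ det-suc M ⟩
    cofactorTerm M zero + sum (λ j → - s j * (x j * det (suc n) (minor M zero (suc j))))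
      ≡⟨ cong (cofactorTerm M zero +_) (sum-cong-≗ λ j →
           cong (λ d → - s j * (x j * d)) (det≡columnExpansion n (minor M zero (suc j)))) ⟩
    cofactorTerm M zero + sum (λ j → - s j * (x j * sum (λ i → s i * (y i * D i j))))
      ≡⟨ cong (cofactorTerm M zero +_) swap ⟩
    cofactorTerm M zero + sum (λ i → - s i * (y i * sum (λ j → s j * (x j * D i j))))
      ≡⟨ cong (cofactorTerm M zero +_) (sum-cong-≗ λ i →
           cong (λ d → - s i * (y i * d)) (det-suc (minor M (suc i) zero))) ⟨
    cofactorTerm M zero + sum (λ i → - s i * (y i * det (suc n) (minor M (suc i) zero)))
      ∎
    where
    -- Expanding the minors once more, both sides become the same double sum over the
    -- minors D i j of M with rows {0, i+1} and columns {0, j+1} deleted.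
    s x y : Fin (suc n) → ℚ
    s i = sign (toℕ i)
    x j = M zero (suc j)
    y i = M (suc i) zero
    D : Fin (suc n) → Fin (suc n) → ℚ
    D i j = det n (λ r c → M (suc (punchIn i r)) (suc (punchIn j c)))

    exchange : ∀ a b c d e → - a * (b * (c * (d * e))) ≡ - c * (d * (a * (b * e)))
    exchange = solve 5 (λ a b c d e → (:- a) :* (b :* (c :* (d :* e)))
                                    := (:- c) :* (d :* (a :* (b :* e)))) refl

    swap : sum (λ j → - s j * (x j * sum (λ i → s i * (y i * D i j))))
         ≡ sum (λ i → - s i * (y i * sum (λ j → s j * (x j * D i j))))
    swap = begin
      sum (λ j → - s j * (x j * sum (λ i → s i * (y i * D i j))))
        ≡⟨ sum-cong-≗ (λ j → *-distribˡ-sum² (- s j) (x j) (λ i → s i * (y i * D i j))) ⟩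
      sum (λ j → sum (λ i → - s j * (x j * (s i * (y i * D i j)))))
        ≡⟨ ∑-comm (λ j i → - s j * (x j * (s i * (y i * D i j)))) ⟩
      sum (λ i → sum (λ j → - s j * (x j * (s i * (y i * D i j)))))
        ≡⟨ sum-cong-≗ (λ i → sum-cong-≗ (λ j → exchange (s j) (x j) (s i) (y i) (D i j))) ⟩
      sum (λ i → sum (λ j → - s i * (y i * (s j * (x j * D i j)))))
        ≡⟨ sum-cong-≗ (λ i → *-distribˡ-sum² (- s i) (y i) (λ j → s j * (x j * D i j))) ⟨
      sum (λ i → - s i * (y i * sum (λ j → s j * (x j * D i j))))
        ∎

  det-pivot : ∀ n (M : Matrix (suc n)) → (∀ i → M (suc i) zero ≡ 0ℚ) →
              det (suc n) M ≡ M zero zero * det n (minor M zero zero)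
  det-pivot n M column≡0 = begin
    det (suc n) M
      ≡⟨ det≡columnExpansion n M ⟩
    1ℚ * (M zero zero * det n (minor M zero zero)) + sum below
      ≡⟨ cong₂ _+_ (ℚ.*-identityˡ (M zero zero * det n (minor M zero zero))) (sum-zero below≡0) ⟩
    M zero zero * det n (minor M zero zero) + 0ℚ
      ≡⟨ ℚ.+-identityʳ (M zero zero * det n (minor M zero zero)) ⟩
    M zero zero * det n (minor M zero zero)
      ∎
    where
    below : Fin n → ℚ
    below i = sign (toℕ (suc i)) * (M (suc i) zero * det n (minor M (suc i) zero))
    below≡0 : ∀ i → below i ≡ 0ℚ
    below≡0 i = trans (cong (λ m → s * (m * d)) (column≡0 i)) (trans (cong (s *_) (ℚ.*-zeroˡ d)) (ℚ.*-zeroʳ s))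
      where
      s = sign (toℕ (suc i))
      d = det n (minor M (suc i) zero)

  private
    det-additive-termwise : ∀ {n} {A B C : Matrix (suc n)} →
                            (∀ j → cofactorTerm C j ≡ cofactorTerm A j + cofactorTerm B j) →
                            det (suc n) C ≡ det (suc n) A + det (suc n) B
    det-additive-termwise {n} {A} {B} {C} terms≡ = begin
      det (suc n) C                                   ≡⟨ det-suc C ⟩
      sum (cofactorTerm C)                            ≡⟨ sum-cong-≗ terms≡ ⟩
      sum (λ j → cofactorTerm A j + cofactorTerm B j) ≡⟨ ∑-distrib-+ (cofactorTerm A) (cofactorTerm B) ⟩
      sum (cofactorTerm A) + sum (cofactorTerm B)     ≡⟨ cong₂ _+_ (det-suc A) (det-suc B) ⟨
      det (suc n) A + det (suc n) B                   ∎

  det-additive : ∀ n (p : Fin n) {A B C : Matrix n} →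
                 (∀ i → i ≢ p → ∀ j → A i j ≡ C i j) →
                 (∀ i → i ≢ p → ∀ j → B i j ≡ C i j) →
                 (∀ j → C p j ≡ A p j + B p j) →
                 det n C ≡ det n A + det n B
  det-additive (suc n) zero {A} {B} {C} A≈C B≈C C≡A+B = det-additive-termwise {A = A} {B} {C} terms≡
    where
    terms≡ : ∀ j → cofactorTerm C j ≡ cofactorTerm A j + cofactorTerm B j
    terms≡ j = begin
      s * (C zero j * dC)                        ≡⟨ cong (λ c → s * (c * dC)) (C≡A+B j) ⟩
      s * ((A zero j + B zero j) * dC)           ≡⟨ cong (s *_) (ℚ.*-distribʳ-+ dC (A zero j) (B zero j)) ⟩
      s * (A zero j * dC + B zero j * dC)        ≡⟨ ℚ.*-distribˡ-+ s (A zero j * dC) (B zero j * dC) ⟩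
      s * (A zero j * dC) + s * (B zero j * dC)  ≡⟨ cong₂ (λ a b → s * (A zero j * a) + s * (B zero j * b))
                                                          dA≡dC dB≡dC ⟨
      cofactorTerm A j + cofactorTerm B j        ∎
      where
      s = sign (toℕ j)
      dC = det n (minor C zero j)
      dA≡dC : det n (minor A zero j) ≡ dC
      dA≡dC = det-cong n (λ r c → A≈C (suc r) (λ ()) (punchIn j c))
      dB≡dC : det n (minor B zero j) ≡ dC
      dB≡dC = det-cong n (λ r c → B≈C (suc r) (λ ()) (punchIn j c))
  det-additive (suc n) (suc p) {A} {B} {C} A≈C B≈C C≡A+B = det-additive-termwise {A = A} {B} {C} terms≡
    where
    terms≡ : ∀ j → cofactorTerm C j ≡ cofactorTerm A j + cofactorTerm B j
    terms≡ j = begin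
      s * (C zero j * det n (minor C zero j))    ≡⟨ cong (λ d → s * (C zero j * d)) minor-additive ⟩
      s * (C zero j * (dA + dB))                 ≡⟨ cong (s *_) (ℚ.*-distribˡ-+ (C zero j) dA dB) ⟩
      s * (C zero j * dA + C zero j * dB)        ≡⟨ ℚ.*-distribˡ-+ s (C zero j * dA) (C zero j * dB) ⟩
      s * (C zero j * dA) + s * (C zero j * dB)  ≡⟨ cong₂ (λ a b → s * (a * dA) + s * (b * dB))
                                                          (A≈C zero (λ ()) j) (B≈C zero (λ ()) j) ⟨
      cofactorTerm A j + cofactorTerm B j        ∎
      where
      s = sign (toℕ j)
      dA = det n (minor A zero j)
      dB = det n (minor B zero j)
      minor-additive : det n (minor C zero j) ≡ dA + dB
      minor-additive = det-additive n p
        (λ r r≢p c → A≈C (suc r) (r≢p ∘ Fin.suc-injective) (punchIn j c))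
        (λ r r≢p c → B≈C (suc r) (r≢p ∘ Fin.suc-injective) (punchIn j c))
        (λ c → C≡A+B (punchIn j c))

  adjacentRows⇒det≡0 : ∀ n (r : Fin (suc n)) (M : Matrix (suc (suc n))) →
                       (∀ j → M (inject₁ r) j ≡ M (suc r) j) → det (suc (suc n)) M ≡ 0ℚ
  -- Along the first column the first two terms cancel, and every other minor again has
  -- two equal adjacent rows.
  adjacentRows⇒det≡0 n zero M rows≡ = begin
    det (suc (suc n)) M                               ≡⟨ det≡columnExpansion (suc n) M ⟩
    1ℚ * (M zero zero * d₀) + (- 1ℚ * t + sum rest)   ≡⟨ cong₂ (λ a b → 1ℚ * a + (- 1ℚ * t + b))
                                                                (cong₂ _*_ (rows≡ zero) d₀≡d₁) (sum-zero rest≡0) ⟩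
    1ℚ * t + (- 1ℚ * t + 0ℚ)                          ≡⟨ cancel t ⟩
    0ℚ                                                ∎
    where
    d₀ = det (suc n) (minor M zero zero)
    t = M (suc zero) zero * det (suc n) (minor M (suc zero) zero)
    rest : Fin n → ℚ
    rest i = sign (toℕ (suc (suc i))) * (M (suc (suc i)) zero * det (suc n) (minor M (suc (suc i)) zero))

    d₀≡d₁ : d₀ ≡ det (suc n) (minor M (suc zero) zero)
    d₀≡d₁ = det-cong (suc n) {minor M zero zero} {minor M (suc zero) zero}
                     λ { zero c → sym (rows≡ (suc c)) ; (suc r) c → refl }

    minors≡0 : ∀ {n} (M : Matrix (suc (suc n))) → (∀ j → M zero j ≡ M (suc zero) j) →
               (i : Fin n) → det (suc n) (minor M (suc (suc i)) zero) ≡ 0ℚ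
    minors≡0 {suc n} M rows≡ i = adjacentRows⇒det≡0 n zero (minor M (suc (suc i)) zero) (rows≡ ∘ suc)

    rest≡0 : ∀ i → rest i ≡ 0ℚ
    rest≡0 i = *-zeroʳ² (sign (toℕ (suc (suc i)))) (M (suc (suc i)) zero) (minors≡0 M rows≡ i)

    cancel : ∀ t → 1ℚ * t + (- 1ℚ * t + 0ℚ) ≡ 0ℚ
    cancel t = begin
      1ℚ * t + (- 1ℚ * t + 0ℚ) ≡⟨ cong (1ℚ * t +_) (ℚ.+-identityʳ (- 1ℚ * t)) ⟩
      1ℚ * t + - 1ℚ * t        ≡⟨ cong (1ℚ * t +_) (ℚ.neg-distribˡ-* 1ℚ t) ⟨
      1ℚ * t + - (1ℚ * t)      ≡⟨ ℚ.+-inverseʳ (1ℚ * t) ⟩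
      0ℚ                       ∎
  adjacentRows⇒det≡0 (suc n) (suc r) M rows≡ = begin
    det (suc (suc (suc n))) M ≡⟨ det-suc M ⟩
    sum (cofactorTerm M)      ≡⟨ sum-zero (λ j → *-zeroʳ² (sign (toℕ j)) (M zero j) (minor≡0 j)) ⟩
    0ℚ                        ∎
    where
    minor≡0 : ∀ j → det (suc (suc n)) (minor M zero j) ≡ 0ℚ
    minor≡0 j = adjacentRows⇒det≡0 n r (minor M zero j) (λ c → rows≡ (punchIn j c))

  det-addRowAbove : ∀ n (r : Fin (suc n)) {A B : Matrix (suc (suc n))} →
                    (∀ i → i ≢ suc r → ∀ j → A i j ≡ B i j) →
                    (∀ j → B (suc r) j ≡ A (suc r) j + A (inject₁ r) j) →
                    det (suc (suc n)) B ≡ det (suc (suc n)) A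
  det-addRowAbove n r {A} {B} A≈B B≡A+A = begin
    det (suc (suc n)) B                       ≡⟨ det-additive (suc (suc n)) (suc r) A≈B E≈B B≡A+E ⟩
    det (suc (suc n)) A + det (suc (suc n)) E ≡⟨ cong (det (suc (suc n)) A +_)
                                                       (adjacentRows⇒det≡0 n r E E-rows≡) ⟩
    det (suc (suc n)) A + 0ℚ                  ≡⟨ ℚ.+-identityʳ (det (suc (suc n)) A) ⟩
    det (suc (suc n)) A                       ∎
    where
    E : Matrix (suc (suc n))
    E = updateAt A (suc r) (λ _ → A (inject₁ r))

    E-suc : ∀ j → E (suc r) j ≡ A (inject₁ r) j
    E-suc = cong-app (updateAt-updates (suc r) A)
    E-other : ∀ i → i ≢ suc r → ∀ j → E i j ≡ A i j
    E-other i i≢r = cong-app (updateAt-minimal i (suc r) A i≢r)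

    E≈B : ∀ i → i ≢ suc r → ∀ j → E i j ≡ B i j
    E≈B i i≢r j = trans (E-other i i≢r j) (A≈B i i≢r j)
    B≡A+E : ∀ j → B (suc r) j ≡ A (suc r) j + E (suc r) j
    B≡A+E j = trans (B≡A+A j) (cong (A (suc r) j +_) (sym (E-suc j)))
    E-rows≡ : ∀ j → E (inject₁ r) j ≡ E (suc r) j
    E-rows≡ j = trans (E-other (inject₁ r) (Fin.<⇒≢ (Fin.≤̄⇒inject₁< ℕ.≤-refl)) j) (sym (E-suc j))

  -- Passing from hybrid (suc m) to hybrid m subtracts row m from row m + 1, so all the
  -- hybrids have the same determinant.
  module _ {n : ℕ} (R Q : ℕ → Fin n → ℚ) where

    hybrid : ℕ → Matrix n
    hybrid m i with toℕ i ≤? m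
    ... | yes _ = R (toℕ i)
    ... | no  _ = Q (toℕ i)

    hybrid-≤ : ∀ {m} i → toℕ i ≤ m → hybrid m i ≡ R (toℕ i)
    hybrid-≤ {m} i i≤m with toℕ i ≤? m
    ... | yes _   = refl
    ... | no  i≰m = contradiction i≤m i≰m

    hybrid-> : ∀ {m} i → m < toℕ i → hybrid m i ≡ Q (toℕ i)
    hybrid-> {m} i m<i with toℕ i ≤? m
    ... | yes i≤m = contradiction i≤m (ℕ.<⇒≱ m<i)
    ... | no  _   = refl

    hybrid-suc : ∀ {m} i → toℕ i ≢ suc m → hybrid (suc m) i ≡ hybrid m i
    hybrid-suc {m} i i≢1+m with toℕ i ≤? m
    ... | yes i≤m = hybrid-≤ i (ℕ.m≤n⇒m≤1+n i≤m)
    ... | no  i≰m = hybrid-> i (ℕ.≤∧≢⇒< (ℕ.≰⇒> i≰m) (i≢1+m ∘ sym))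

  det-hybrid-suc : ∀ n (R Q : ℕ → Fin n → ℚ) → (∀ t j → R (suc t) j ≡ Q (suc t) j + R t j) →
                   ∀ m → det n (hybrid R Q (suc m)) ≡ det n (hybrid R Q m)
  det-hybrid-suc n R Q R≡Q+R m with suc m <? n
  ... | no m+1≮n =
    det-cong n λ i → cong-app (hybrid-suc R Q i (λ i≡m+1 → m+1≮n (subst (_< n) i≡m+1 (Fin.toℕ<n i))))
  ... | yes (s≤s (s≤s m≤n)) =
    det-addRowAbove _ r (λ i i≢r → cong-app (sym (hybrid-suc R Q i (i≢r ∘ toℕ≡m+1)))) row≡
    where
    r = fromℕ< (s≤s m≤n)
    r≡m : toℕ r ≡ m
    r≡m = Fin.toℕ-fromℕ< (s≤s m≤n)
    toℕ≡m+1 : ∀ {i} → toℕ i ≡ suc m → i ≡ suc r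
    toℕ≡m+1 i≡m+1 = Fin.toℕ-injective (trans i≡m+1 (cong suc (sym r≡m)))
    row≡ : ∀ j → hybrid R Q (suc m) (suc r) j ≡ hybrid R Q m (suc r) j + hybrid R Q m (inject₁ r) j
    row≡ j = begin
      hybrid R Q (suc m) (suc r) j   ≡⟨ cong-app (hybrid-≤ R Q (suc r) (s≤s (ℕ.≤-reflexive r≡m))) j ⟩
      R (suc (toℕ r)) j               ≡⟨ R≡Q+R (toℕ r) j ⟩
      Q (suc (toℕ r)) j + R (toℕ r) j
        ≡⟨ cong₂ (λ a b → a j + b j) (hybrid-> R Q (suc r) (s≤s (ℕ.≤-reflexive (sym r≡m))))
                                     (trans (hybrid-≤ R Q (inject₁ r) (ℕ.≤-reflexive (trans (Fin.toℕ-inject₁ r) r≡m)))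
                                            (cong R (Fin.toℕ-inject₁ r))) ⟨
      hybrid R Q m (suc r) j + hybrid R Q m (inject₁ r) j ∎

  det-rowPartialSums : ∀ n (R Q : ℕ → Fin n → ℚ) → (∀ j → R 0 j ≡ Q 0 j) →
                       (∀ t j → R (suc t) j ≡ Q (suc t) j + R t j) →
                       det n (R ∘ toℕ) ≡ det n (Q ∘ toℕ)
  det-rowPartialSums n R Q R₀≡Q₀ R≡Q+R = begin
    det n (R ∘ toℕ)      ≡⟨ det-cong n (λ i → cong-app (hybrid-≤ R Q i (ℕ.<⇒≤ (Fin.toℕ<n i)))) ⟨
    det n (hybrid R Q n) ≡⟨ collapse n ⟩
    det n (hybrid R Q 0) ≡⟨ det-cong n hybrid₀ ⟩
    det n (Q ∘ toℕ)      ∎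
    where
    collapse : ∀ m → det n (hybrid R Q m) ≡ det n (hybrid R Q 0)
    collapse zero    = refl
    collapse (suc m) = trans (det-hybrid-suc n R Q R≡Q+R m) (collapse m)
    hybrid₀ : ∀ i j → hybrid R Q 0 i j ≡ Q (toℕ i) j
    hybrid₀ i j with toℕ i ≤? 0
    ... | yes i≤0 = subst (λ t → R t j ≡ Q t j) (sym (ℕ.n≤0⇒n≡0 i≤0)) (R₀≡Q₀ j)
    ... | no  _   = refl


module Ballot where
  open import Data.Nat using (_+_; _*_)
  open import Algebra.Properties.CommutativeSemigroup ℕ.+-commutativeSemigroup using (interchange)
  open ≡-Reasoning

  ballot : ℕ → ℕ → ℕ
  ballot r       zero    = 1
  ballot zero    (suc n) = 0
  ballot (suc r) (suc n) = ballot r (suc n) + ballot (suc (suc r)) n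

  ballot-closedForm : ∀ r n → ballot (suc r) n * (n ! * (n + suc r) !) ≡ suc r * (n + n + r) !
  ballot-closedForm r zero = trans (ℕ.*-identityˡ _) (ℕ.*-identityˡ _)
  ballot-closedForm zero (suc m) = begin
    ballot 2 m * (suc m ! * (suc m + 1) !)    ≡⟨ cong (λ k → ballot 2 m * (suc m ! * k !)) (ℕ.+-suc m 1) ⟨
    ballot 2 m * ((suc m * m !) * (m + 2) !)  ≡⟨ regroup (ballot 2 m) m (m !) ((m + 2) !) ⟩
    suc m * (ballot 2 m * (m ! * (m + 2) !))  ≡⟨ cong (suc m *_) (ballot-closedForm 1 m) ⟩
    suc m * (2 * (m + m + 1) !)               ≡⟨ collect m ((m + m + 1) !) ⟩
    1 * (suc (m + m + 1) !)                   ≡⟨ cong (λ k → 1 * k !) (index m) ⟩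
    1 * (suc m + suc m + 0) !                 ∎
    where
    regroup : ∀ b m f g → b * ((suc m * f) * g) ≡ suc m * (b * (f * g))
    regroup = solve-∀
    collect : ∀ m g → suc m * (2 * g) ≡ 1 * (suc (m + m + 1) * g)
    collect = solve-∀
    index : ∀ m → suc (m + m + 1) ≡ suc m + suc m + 0
    index = solve-∀
  ballot-closedForm (suc r) (suc m) = begin
    (X + Y) * (suc m ! * (suc m + suc (suc r)) !)
      ≡⟨ cong (λ k → (X + Y) * (suc m ! * suc k !)) (ℕ.+-suc m (suc r)) ⟩
    (X + Y) * ((suc m * m !) * (S * (suc m + suc r) !))
      ≡⟨ distribute X Y m (m !) S ((suc m + suc r) !) ⟩
    S * (X * (suc m ! * (suc m + suc r) !)) + suc m * (Y * (m ! * (S * (suc m + suc r) !)))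
      ≡⟨ cong (λ k → S * (X * (suc m ! * (suc m + suc r) !)) + suc m * (Y * (m ! * k !))) index₁ ⟨
    S * (X * (suc m ! * (suc m + suc r) !)) + suc m * (Y * (m ! * (m + suc (suc (suc r))) !))
      ≡⟨ cong₂ (λ a b → S * a + suc m * b) (ballot-closedForm r (suc m)) (ballot-closedForm (suc (suc r)) m) ⟩
    S * (suc r * G !) + suc m * (suc (suc (suc r)) * (m + m + suc (suc r)) !)
      ≡⟨ cong (λ k → S * (suc r * G !) + suc m * (suc (suc (suc r)) * k !)) index₂ ⟩
    S * (suc r * G !) + suc m * (suc (suc (suc r)) * G !)
      ≡⟨ collect m r (G !) ⟩
    suc (suc r) * (suc G !)
      ≡⟨ cong (λ k → suc (suc r) * k !) index₃ ⟩
    suc (suc r) * (suc m + suc m + suc r) !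
      ∎
    where
    X = ballot (suc r) (suc m)
    Y = ballot (suc (suc (suc r))) m
    S = suc (suc m + suc r)
    G = suc m + suc m + r
    distribute : ∀ x y m f s g → (x + y) * ((suc m * f) * (s * g))
                                 ≡ s * (x * ((suc m * f) * g)) + suc m * (y * (f * (s * g)))
    distribute = solve-∀
    collect : ∀ m r g → suc (suc m + suc r) * (suc r * g) + suc m * (suc (suc (suc r)) * g)
                        ≡ suc (suc r) * (suc (suc m + suc m + r) * g)
    collect = solve-∀
    index₁ : m + suc (suc (suc r)) ≡ S
    index₁ = trans (ℕ.+-suc m (suc (suc r))) (cong suc (ℕ.+-suc m (suc r)))
    index₂ : m + m + suc (suc r) ≡ G
    index₂ = shuffle m r
      where
      shuffle : ∀ m r → m + m + suc (suc r) ≡ suc m + suc m + r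
      shuffle = solve-∀
    index₃ : suc G ≡ suc m + suc m + suc r
    index₃ = sym (cong suc (ℕ.+-suc (m + suc m) r))

  -- binomialBallot s k n = Σₘ (k choose m) · ballot (s + m) n
  binomialBallot : ℕ → ℕ → ℕ → ℕ
  binomialBallot s zero    n = ballot s n
  binomialBallot s (suc k) n = binomialBallot (suc s) k n + binomialBallot s k n

  binomialBallot-at0 : ∀ s k → binomialBallot s k 0 ≡ 2 ^ k
  binomialBallot-at0 s zero    = refl
  binomialBallot-at0 s (suc k) = begin
    binomialBallot (suc s) k 0 + binomialBallot s k 0 ≡⟨ cong₂ _+_ (binomialBallot-at0 (suc s) k)
                                                                   (binomialBallot-at0 s k) ⟩
    2 ^ k + 2 ^ k                                     ≡⟨ cong (2 ^ k +_) (ℕ.+-identityʳ (2 ^ k)) ⟨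
    2 ^ suc k                                         ∎

  binomialBallot-rowStep : ∀ s k n →
    binomialBallot (2 + s) k (suc n) ≡ binomialBallot (2 + s) (suc k) n + binomialBallot s k (suc n)
  binomialBallot-rowStep s zero n = regroup (ballot s (suc n)) (ballot (2 + s) n) (ballot (3 + s) n)
    where
    regroup : ∀ x y z → (x + y) + z ≡ (z + y) + x
    regroup = solve-∀
  binomialBallot-rowStep s (suc k) n = begin
    binomialBallot (3 + s) k (suc n) + binomialBallot (2 + s) k (suc n)
      ≡⟨ cong₂ _+_ (binomialBallot-rowStep (suc s) k n) (binomialBallot-rowStep s k n) ⟩
    (binomialBallot (3 + s) (suc k) n + binomialBallot (suc s) k (suc n))
      + (binomialBallot (2 + s) (suc k) n + binomialBallot s k (suc n))
      ≡⟨ interchange (binomialBallot (3 + s) (suc k) n) (binomialBallot (suc s) k (suc n))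
                     (binomialBallot (2 + s) (suc k) n) (binomialBallot s k (suc n)) ⟩
    (binomialBallot (3 + s) (suc k) n + binomialBallot (2 + s) (suc k) n)
      + (binomialBallot (suc s) k (suc n) + binomialBallot s k (suc n))
      ∎

module FromNat where
  open import Data.Rational using (_+_; _*_; _/_; toℚᵘ; fromℚᵘ)
  open import Data.Rational.Unnormalised using (ℚᵘ; mkℚᵘ; *≡*)

  -- fromℕ m is definitionally fromℚᵘ (fromℕᵘ m); the homomorphism laws are proved in ℚᵘ.
  fromℕ : ℕ → ℚ
  fromℕ m = ℤ.+ m / 1

  private
    fromℕᵘ : ℕ → ℚᵘ
    fromℕᵘ m = mkℚᵘ (ℤ.+ m) 0

    fromℚᵘ-homo-+ : ∀ p q → fromℚᵘ (p ℚᵘ.+ q) ≡ fromℚᵘ p + fromℚᵘ q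
    fromℚᵘ-homo-+ p q = ℚ.toℚᵘ-injective (begin
      toℚᵘ (fromℚᵘ (p ℚᵘ.+ q))               ≈⟨ ℚ.toℚᵘ-fromℚᵘ (p ℚᵘ.+ q) ⟩
      p ℚᵘ.+ q                               ≈⟨ ℚᵘ.+-cong (ℚ.toℚᵘ-fromℚᵘ p) (ℚ.toℚᵘ-fromℚᵘ q) ⟨
      toℚᵘ (fromℚᵘ p) ℚᵘ.+ toℚᵘ (fromℚᵘ q)  ≈⟨ ℚ.toℚᵘ-homo-+ (fromℚᵘ p) (fromℚᵘ q) ⟨
      toℚᵘ (fromℚᵘ p + fromℚᵘ q)             ∎)
      where open ℚᵘ.≃-Reasoning

    fromℚᵘ-homo-* : ∀ p q → fromℚᵘ (p ℚᵘ.* q) ≡ fromℚᵘ p * fromℚᵘ q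
    fromℚᵘ-homo-* p q = ℚ.toℚᵘ-injective (begin
      toℚᵘ (fromℚᵘ (p ℚᵘ.* q))               ≈⟨ ℚ.toℚᵘ-fromℚᵘ (p ℚᵘ.* q) ⟩
      p ℚᵘ.* q                               ≈⟨ ℚᵘ.*-cong (ℚ.toℚᵘ-fromℚᵘ p) (ℚ.toℚᵘ-fromℚᵘ q) ⟨
      toℚᵘ (fromℚᵘ p) ℚᵘ.* toℚᵘ (fromℚᵘ q)  ≈⟨ ℚ.toℚᵘ-homo-* (fromℚᵘ p) (fromℚᵘ q) ⟨
      toℚᵘ (fromℚᵘ p * fromℚᵘ q)             ∎)
      where open ℚᵘ.≃-Reasoning

  fromℕ-homo-+ : ∀ m n → fromℕ (m ℕ.+ n) ≡ fromℕ m + fromℕ n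
  fromℕ-homo-+ m n = trans (ℚ.fromℚᵘ-cong {fromℕᵘ (m ℕ.+ n)} {fromℕᵘ m ℚᵘ.+ fromℕᵘ n}
                             (*≡* (cong (ℤ._* ℤ.+ 1) +[m+n]≡m*1+n*1)))
                           (fromℚᵘ-homo-+ (fromℕᵘ m) (fromℕᵘ n))
    where
    +[m+n]≡m*1+n*1 : ℤ.+ (m ℕ.+ n) ≡ ℤ.+ m ℤ.* ℤ.+ 1 ℤ.+ ℤ.+ n ℤ.* ℤ.+ 1
    +[m+n]≡m*1+n*1 = trans (ℤ.pos-+ m n)
                           (sym (cong₂ ℤ._+_ (ℤ.*-identityʳ (ℤ.+ m)) (ℤ.*-identityʳ (ℤ.+ n))))

  fromℕ-homo-* : ∀ m n → fromℕ (m ℕ.* n) ≡ fromℕ m * fromℕ n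
  fromℕ-homo-* m n = trans (ℚ.fromℚᵘ-cong {fromℕᵘ (m ℕ.* n)} {fromℕᵘ m ℚᵘ.* fromℕᵘ n}
                             (*≡* (cong (ℤ._* ℤ.+ 1) (ℤ.pos-* m n))))
                           (fromℚᵘ-homo-* (fromℕᵘ m) (fromℕᵘ n))

  m*n/n≡fromℕ : ∀ m n .{{_ : ℕ.NonZero n}} → ℤ.+ (m ℕ.* n) / n ≡ fromℕ m
  m*n/n≡fromℕ m (suc n) = ℚ.fromℚᵘ-cong {mkℚᵘ (ℤ.+ (m ℕ.* suc n)) n} {fromℕᵘ m}
                            (*≡* (trans (ℤ.*-identityʳ (ℤ.+ (m ℕ.* suc n))) (ℤ.pos-* m (suc n))))

module BallotDeterminant where
  open import Data.Rational using (_+_; _*_)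
  open Determinant
  open Ballot
  open FromNat
  open ≡-Reasoning

  ballotRow : ∀ {n} → ℕ → ℕ → ℕ → Fin n → ℚ
  ballotRow s k t j = fromℕ (binomialBallot (s ℕ.+ 2 ℕ.* t) k (toℕ j))

  ballotMatrix : ∀ N → ℕ → ℕ → Matrix (suc N)
  ballotMatrix N s k i = ballotRow s k (toℕ i)

  differencedRow : ∀ {n} → ℕ → ℕ → ℕ → Fin (suc n) → ℚ
  differencedRow s k zero    j       = ballotRow s k 0 j
  differencedRow s k (suc t) zero    = 0ℚ
  differencedRow s k (suc t) (suc j) = ballotRow (2 ℕ.+ s) (suc k) t j

  ballotRow-differences : ∀ {n} s k t (j : Fin (suc n)) →
                          ballotRow s k (suc t) j ≡ differencedRow s k (suc t) j + ballotRow s k t j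
  ballotRow-differences s k t zero = begin
    fromℕ (binomialBallot (s ℕ.+ 2 ℕ.* suc t) k 0)
      ≡⟨ cong fromℕ (trans (binomialBallot-at0 _ k) (sym (binomialBallot-at0 _ k))) ⟩
    fromℕ (binomialBallot (s ℕ.+ 2 ℕ.* t) k 0)
      ≡⟨ ℚ.+-identityˡ (fromℕ (binomialBallot (s ℕ.+ 2 ℕ.* t) k 0)) ⟨
    0ℚ + fromℕ (binomialBallot (s ℕ.+ 2 ℕ.* t) k 0)
      ∎
  ballotRow-differences s k t (suc j) = begin
    fromℕ (binomialBallot (s ℕ.+ 2 ℕ.* suc t) k (suc (toℕ j)))
      ≡⟨ cong (λ u → fromℕ (binomialBallot u k (suc (toℕ j)))) (shift s t) ⟩
    fromℕ (binomialBallot (2 ℕ.+ s′) k (suc (toℕ j)))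
      ≡⟨ cong fromℕ (binomialBallot-rowStep s′ k (toℕ j)) ⟩
    fromℕ (binomialBallot (2 ℕ.+ s′) (suc k) (toℕ j) ℕ.+ binomialBallot s′ k (suc (toℕ j)))
      ≡⟨ fromℕ-homo-+ (binomialBallot (2 ℕ.+ s′) (suc k) (toℕ j)) (binomialBallot s′ k (suc (toℕ j))) ⟩
    ballotRow (2 ℕ.+ s) (suc k) t j + ballotRow s k t (suc j)
      ∎
    where
    s′ = s ℕ.+ 2 ℕ.* t
    shift : ∀ s t → s ℕ.+ 2 ℕ.* suc t ≡ 2 ℕ.+ (s ℕ.+ 2 ℕ.* t)
    shift = solve-∀

  private
    exponent-step : ∀ N k → 2 ^ k ℕ.* 2 ^ (suc k ℕ.* suc N ℕ.+ N ℕ.* suc N ℕ./ 2)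
                            ≡ 2 ^ (k ℕ.* suc (suc N) ℕ.+ suc N ℕ.* suc (suc N) ℕ./ 2)
    exponent-step N k = begin
      2 ^ k ℕ.* 2 ^ (suc k ℕ.* suc N ℕ.+ T)       ≡⟨ ℕ.^-distribˡ-+-* 2 k (suc k ℕ.* suc N ℕ.+ T) ⟨
      2 ^ (k ℕ.+ (suc k ℕ.* suc N ℕ.+ T))          ≡⟨ cong (2 ^_) (regroup k N T) ⟩
      2 ^ (k ℕ.* suc (suc N) ℕ.+ (T ℕ.+ suc N))    ≡⟨ cong (λ e → 2 ^ (k ℕ.* suc (suc N) ℕ.+ e)) triangle-suc ⟨
      2 ^ (k ℕ.* suc (suc N) ℕ.+ suc N ℕ.* suc (suc N) ℕ./ 2) ∎
      where
      T = N ℕ.* suc N ℕ./ 2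
      regroup : ∀ k N T → k ℕ.+ (suc k ℕ.* suc N ℕ.+ T) ≡ k ℕ.* suc (suc N) ℕ.+ (T ℕ.+ suc N)
      regroup = solve-∀
      expand : ∀ N → suc N ℕ.* suc (suc N) ≡ N ℕ.* suc N ℕ.+ suc N ℕ.* 2
      expand = solve-∀
      triangle-suc : suc N ℕ.* suc (suc N) ℕ./ 2 ≡ T ℕ.+ suc N
      triangle-suc = begin
        suc N ℕ.* suc (suc N) ℕ./ 2               ≡⟨ ℕ./-congˡ (expand N) ⟩
        (N ℕ.* suc N ℕ.+ suc N ℕ.* 2) ℕ./ 2        ≡⟨ ℕ.+-distrib-/-∣ʳ (N ℕ.* suc N) (ℕ.n∣m*n (suc N)) ⟩
        T ℕ.+ suc N ℕ.* 2 ℕ./ 2                    ≡⟨ cong (T ℕ.+_) (ℕ.m*n/n≡m (suc N) 2) ⟩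
        T ℕ.+ suc N                                ∎

  det-ballotMatrix : ∀ N s k →
    det (suc N) (ballotMatrix N s k) ≡ fromℕ (2 ^ (k ℕ.* suc N ℕ.+ N ℕ.* suc N ℕ./ 2))
  det-ballotMatrix zero s k = begin
    det 1 (ballotMatrix 0 s k)                 ≡⟨ det-pivot 0 (ballotMatrix 0 s k) (λ ()) ⟩
    fromℕ (binomialBallot (s ℕ.+ 0) k 0) * 1ℚ  ≡⟨ ℚ.*-identityʳ (fromℕ (binomialBallot (s ℕ.+ 0) k 0)) ⟩
    fromℕ (binomialBallot (s ℕ.+ 0) k 0)       ≡⟨ cong fromℕ (binomialBallot-at0 (s ℕ.+ 0) k) ⟩
    fromℕ (2 ^ k)                              ≡⟨ cong (λ e → fromℕ (2 ^ e)) k*1+0≡k ⟨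
    fromℕ (2 ^ (k ℕ.* 1 ℕ.+ 0))                ∎
    where
    k*1+0≡k : k ℕ.* 1 ℕ.+ 0 ≡ k
    k*1+0≡k = trans (ℕ.+-identityʳ (k ℕ.* 1)) (ℕ.*-identityʳ k)
  det-ballotMatrix (suc N) s k = begin
    det (suc (suc N)) (ballotMatrix (suc N) s k)
      ≡⟨ det-rowPartialSums (suc (suc N)) (ballotRow s k) (differencedRow s k)
                            (λ _ → refl) (ballotRow-differences s k) ⟩
    det (suc (suc N)) (differencedRow s k ∘ toℕ)
      ≡⟨ det-pivot (suc N) (differencedRow s k ∘ toℕ) (λ _ → refl) ⟩
    fromℕ (binomialBallot (s ℕ.+ 0) k 0) * det (suc N) (ballotMatrix N (2 ℕ.+ s) (suc k))
      ≡⟨ cong₂ _*_ (cong fromℕ (binomialBallot-at0 (s ℕ.+ 0) k)) (det-ballotMatrix N (2 ℕ.+ s) (suc k)) ⟩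
    fromℕ (2 ^ k) * fromℕ (2 ^ (suc k ℕ.* suc N ℕ.+ N ℕ.* suc N ℕ./ 2))
      ≡⟨ fromℕ-homo-* (2 ^ k) (2 ^ (suc k ℕ.* suc N ℕ.+ N ℕ.* suc N ℕ./ 2)) ⟨
    fromℕ (2 ^ k ℕ.* 2 ^ (suc k ℕ.* suc N ℕ.+ N ℕ.* suc N ℕ./ 2))
      ≡⟨ cong fromℕ (exponent-step N k) ⟩
    fromℕ (2 ^ (k ℕ.* suc (suc N) ℕ.+ suc N ℕ.* suc (suc N) ℕ./ 2))
      ∎

  entry≡ballot : ∀ i j → entry i j ≡ fromℕ (ballot (suc (2 ℕ.* i)) j)
  entry≡ballot i j = trans (ℚ./-cong {q₁ = d} (cong ℤ.+_ numerator≡) refl)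
                           (m*n/n≡fromℕ (ballot (suc (2 ℕ.* i)) j) d)
    where
    d = j ! ℕ.* (2 ℕ.* i ℕ.+ j ℕ.+ 1) !
    instance
      d≢0 : ℕ.NonZero d
      d≢0 = ℕ._!*_!≢0 j (2 ℕ.* i ℕ.+ j ℕ.+ 1)
    numerator≡ : (2 ℕ.* i ℕ.+ 1) ℕ.* (2 ℕ.* (i ℕ.+ j)) ! ≡ ballot (suc (2 ℕ.* i)) j ℕ.* d
    numerator≡ = begin
      (2 ℕ.* i ℕ.+ 1) ℕ.* (2 ℕ.* (i ℕ.+ j)) !
        ≡⟨ cong₂ (λ a b → a ℕ.* b !) (ℕ.+-comm (2 ℕ.* i) 1) (double i j) ⟩
      suc (2 ℕ.* i) ℕ.* (j ℕ.+ j ℕ.+ 2 ℕ.* i) !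
        ≡⟨ ballot-closedForm (2 ℕ.* i) j ⟨
      ballot (suc (2 ℕ.* i)) j ℕ.* (j ! ℕ.* (j ℕ.+ suc (2 ℕ.* i)) !)
        ≡⟨ cong (λ a → ballot (suc (2 ℕ.* i)) j ℕ.* (j ! ℕ.* a !)) (reorder i j) ⟩
      ballot (suc (2 ℕ.* i)) j ℕ.* d
        ∎
      where
      double : ∀ i j → 2 ℕ.* (i ℕ.+ j) ≡ j ℕ.+ j ℕ.+ 2 ℕ.* i
      double = solve-∀
      reorder : ∀ i j → j ℕ.+ suc (2 ℕ.* i) ≡ 2 ℕ.* i ℕ.+ j ℕ.+ 1
      reorder = solve-∀

open Determinant using (det-cong)
open BallotDeterminant using (ballotMatrix; det-ballotMatrix; entry≡ballot)
open import Data.Integer using (+_)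
open import Data.Nat using (_*_)
import Data.Rational
open ≡-Reasoning

theorem8p1 : (N : ℕ) →
    det (suc N) (λ i j → entry (toℕ i) (toℕ j))
      ≡ (+ (2 ^ Data.Nat._/_ (N * suc N) 2)) Data.Rational./ 1
theorem8p1 N = begin
  det (suc N) (λ i j → entry (toℕ i) (toℕ j))
    ≡⟨ det-cong (suc N) (λ i j → entry≡ballot (toℕ i) (toℕ j)) ⟩
  det (suc N) (ballotMatrix N 1 0)
    ≡⟨ det-ballotMatrix N 1 0 ⟩
  (+ (2 ^ Data.Nat._/_ (N * suc N) 2)) Data.Rational./ 1
    ∎
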